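{- Let $G$ be a simple graph and let $H$ be a clique, a biclique, or a windmill. Then every edge-injective homomorphism from $H$ to $G$ is an embedding (i.e., injective on vertices).
   Context: A homomorphism from $H$ to $G$ is a map $\varphi:V(H)\to V(G)$ with $\{\varphi(u),\varphi(v)\}\in E(G)$ for all $\{u,v\}\in E(H)$; it is edge-injective if distinct edges of $H$ map to distinct edges of $G$. A biclique is a complete bipartite graph. A windmill $W_k$ is a matching with $k$ edges together with a center vertex adjacent to every other vertex. -}

module Defs where

open import Data.Nat using (ℕ; suc)
open import Data.Fin using (Fin)
open import Data.Sum using (_⊎_; inj₁; inj₂)
open import Data.Product using (_×_; _,_)
open import Data.Bool using (Bool; true; false)
open import Data.Maybe using (Maybe; just; nothing)
open import Relation.Nullary using (¬_)
open import Relation.Binary.PropositionalEquality using (_≡_; _≢_; refl) renaming (sym to ≡-sym)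

record Graph : Set₁ where
  field
    V      : Set
    Adj    : V → V → Set
    sym    : ∀ {u v} → Adj u v → Adj v u
    irrefl : ∀ {v} → ¬ Adj v v
open Graph public

SamePair : {A : Set} → A → A → A → A → Set
SamePair a b c d = (a ≡ c × b ≡ d) ⊎ (a ≡ d × b ≡ c)

IsHom : (H G : Graph) → (V H → V G) → Set
IsHom H G φ = ∀ {u v} → Adj H u v → Adj G (φ u) (φ v)

EdgeInjective : (H G : Graph) → (V H → V G) → Set
EdgeInjective H G φ = ∀ {u v x y} → Adj H u v → Adj H x y →
  SamePair (φ u) (φ v) (φ x) (φ y) → SamePair u v x y

VertexInjective : (H G : Graph) → (V H → V G) → Set
VertexInjective H G φ = ∀ {u v} → φ u ≡ φ v → u ≡ v

Clique : ℕ → Graph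
Clique n = record
  { V = Fin n ; Adj = λ i j → i ≢ j
  ; sym = λ p q → p (≡-sym q)
  ; irrefl = λ p → p refl }

data BiAdj {a b : ℕ} : Fin a ⊎ Fin b → Fin a ⊎ Fin b → Set where
  lr : ∀ i j → BiAdj (inj₁ i) (inj₂ j)
  rl : ∀ i j → BiAdj (inj₂ j) (inj₁ i)

biSym : ∀ {a b} {u v : Fin a ⊎ Fin b} → BiAdj u v → BiAdj v u
biSym (lr i j) = rl i j
biSym (rl i j) = lr i j

biIrr : ∀ {a b} {v : Fin a ⊎ Fin b} → ¬ BiAdj v v
biIrr ()

Biclique : ℕ → ℕ → Graph
Biclique a b = record { V = Fin a ⊎ Fin b ; Adj = BiAdj ; sym = biSym ; irrefl = biIrr }

-- Windmill W_k: center 'nothing', matching vertices 'just (i , s)',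
-- matching edges {(i,true),(i,false)}, center adjacent to all others.
data WAdj {k : ℕ} : Maybe (Fin k × Bool) → Maybe (Fin k × Bool) → Set where
  matchTF : ∀ i → WAdj (just (i , true)) (just (i , false))
  matchFT : ∀ i → WAdj (just (i , false)) (just (i , true))
  out     : ∀ x → WAdj nothing (just x)
  into    : ∀ x → WAdj (just x) nothing

wSym : ∀ {k} {u v : Maybe (Fin k × Bool)} → WAdj u v → WAdj v u
wSym (matchTF i) = matchFT i
wSym (matchFT i) = matchTF i
wSym (out x) = into x
wSym (into x) = out x

wIrr : ∀ {k} {v : Maybe (Fin k × Bool)} → ¬ WAdj v v
wIrr ()

Windmill : ℕ → Graph
Windmill k = record { V = Maybe (Fin k × Bool) ; Adj = WAdj ; sym = wSym ; irrefl = wIrr }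

-- The three families of pattern graphs H in the statement.
-- Bicliques K_{a,b} are required to have both sides nonempty
-- (K_{0,b} is edgeless, and the claim fails for it when b ≥ 2).
data Family : Set where
  clique   : (n : ℕ) → Family
  biclique : (a b : ℕ) → Family
  windmill : (k : ℕ) → Family

FamilyGraph : Family → Graph
FamilyGraph (clique n)     = Clique n
FamilyGraph (biclique a b) = Biclique (suc a) (suc b)
FamilyGraph (windmill k)   = Windmill k

module Submission where

-- Let φ : H → G be an edge-injective homomorphism into a simple
-- graph G and suppose φ u ≡ φ v.
--   * If u and v are adjacent, then φ u and φ v are adjacent in G, so G
--     would have a loop at φ u; impossible.
--   * If u and v have a common neighbour w, then the edges {u,w} and
--     {v,w} have the same image, so edge-injectivity forces u ≡ v.
-- Hence φ is injective as soon as any two vertices of H are equal,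
-- adjacent, or have a common neighbour ("H has diameter at most 2").

open import Defs
open import Data.Nat using (ℕ; suc)
open import Data.Fin using (zero)
open import Data.Fin.Properties using (_≟_)
open import Data.Sum using (_⊎_; inj₁; inj₂)
open import Data.Product using (_×_; _,_; ∃)
open import Data.Maybe using (just; nothing)
open import Data.Empty using (⊥-elim)
open import Relation.Nullary using (yes; no)
open import Relation.Binary.PropositionalEquality using (_≡_; refl; trans; subst)
  renaming (sym to ≡-sym)

CommonNeighbour : (H : Graph) → V H → V H → Set
CommonNeighbour H u v = ∃ λ w → Adj H u w × Adj H v w

DiameterAtMost2 : Graph → Set
DiameterAtMost2 H = ∀ u v → u ≡ v ⊎ Adj H u v ⊎ CommonNeighbour H u v

hom-separates-adjacent : (H G : Graph) (φ : V H → V G) → IsHom H G φ →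
                         ∀ {u v} → Adj H u v → φ u ≡ φ v → u ≡ v
hom-separates-adjacent H G φ hom uv φu≡φv =
  ⊥-elim (irrefl G (subst (Adj G (φ _)) (≡-sym φu≡φv) (hom uv)))

edgeInj-separates-common-neighbours :
  (H G : Graph) (φ : V H → V G) → EdgeInjective H G φ →
  ∀ {u v} → CommonNeighbour H u v → φ u ≡ φ v → u ≡ v
edgeInj-separates-common-neighbours H G φ ei (w , uw , vw) φu≡φv
  with ei uw vw (inj₁ (φu≡φv , refl))
... | inj₁ (u≡v , _)   = u≡v
... | inj₂ (u≡w , w≡v) = trans u≡w w≡v

diameter2⇒embedding : (H G : Graph) → DiameterAtMost2 H →
                      (φ : V H → V G) → IsHom H G φ → EdgeInjective H G φ →
                      VertexInjective H G φ
diameter2⇒embedding H G diam φ hom ei {u} {v} φu≡φv with diam u v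
... | inj₁ u≡v        = u≡v
... | inj₂ (inj₁ uv)  = hom-separates-adjacent H G φ hom uv φu≡φv
... | inj₂ (inj₂ cn)  = edgeInj-separates-common-neighbours H G φ ei cn φu≡φv

clique-diameter : (n : ℕ) → DiameterAtMost2 (Clique n)
clique-diameter n u v with u ≟ v
... | yes u≡v = inj₁ u≡v
... | no  u≢v = inj₂ (inj₁ u≢v)

biclique-diameter : (a b : ℕ) → DiameterAtMost2 (Biclique (suc a) (suc b))
biclique-diameter a b (inj₁ i) (inj₁ j) = inj₂ (inj₂ (inj₂ zero , lr i zero , lr j zero))
biclique-diameter a b (inj₁ i) (inj₂ j) = inj₂ (inj₁ (lr i j))
biclique-diameter a b (inj₂ i) (inj₁ j) = inj₂ (inj₁ (rl j i))
biclique-diameter a b (inj₂ i) (inj₂ j) = inj₂ (inj₂ (inj₁ zero , rl zero i , rl zero j))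

windmill-diameter : (k : ℕ) → DiameterAtMost2 (Windmill k)
windmill-diameter k nothing  nothing  = inj₁ refl
windmill-diameter k nothing  (just y) = inj₂ (inj₁ (out y))
windmill-diameter k (just x) nothing  = inj₂ (inj₁ (into x))
windmill-diameter k (just x) (just y) = inj₂ (inj₂ (nothing , into x , into y))

family-diameter : (F : Family) → DiameterAtMost2 (FamilyGraph F)
family-diameter (clique n)     = clique-diameter n
family-diameter (biclique a b) = biclique-diameter a b
family-diameter (windmill k)   = windmill-diameter k

lemma15 : (G : Graph) (F : Family) (φ : V (FamilyGraph F) → V G) →
          IsHom (FamilyGraph F) G φ →
          EdgeInjective (FamilyGraph F) G φ →
          VertexInjective (FamilyGraph F) G φ
lemma15 G F = diameter2⇒embedding (FamilyGraph F) G (family-diameter F)
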